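{- Let $(G,H)$ be a Hamiltonian cubic $3$-pole in which all three segments have odd length. Then $(G,H)$ has a proper $4$-cover.
   Context: Graphs may have multiple edges and dangling edges (edges with exactly one end vertex); no loops. A Hamiltonian cubic $3$-pole $(G,H)$ is a graph $G$ in which every vertex has degree $3$, with exactly three dangling edges $e_1,e_2,e_3$ (spokes), together with a distinguished circuit $H$ through all vertices. Let $v_i$ be the end vertex of $e_i$. The vertices $v_1,v_2,v_3$ split $H$ into three paths, called segments, each joining two of the $v_i$ and not containing the third. A chord is an edge not in $H$; $Q$ is the set of chords. A perfect matching is a set of edges (dangling edges allowed) covering every vertex exactly once. A proper $4$-cover of $(G,H)$ is a set of perfect matchings $M_1,M_2,M_3,M_4$ with every edge in at least one $M_i$, $M_4=Q$, and each spoke lying in exactly two of the $M_i$. -}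

module Defs where

open import Data.Nat using (ℕ; zero; suc; _+_; _*_; _∸_; _<_)
open import Data.Nat.DivMod using (_%_; _mod_)
open import Data.Fin using (Fin; toℕ; _≟_)
open import Data.Bool using (Bool; true; false; if_then_else_; _∧_; _∨_)
open import Data.Product using (_×_; ∃; ∃-syntax)
open import Data.Sum using (_⊎_)
open import Data.Empty using (⊥)
open import Relation.Nullary using (¬_)
open import Relation.Nullary.Decidable using (⌊_⌋)
open import Relation.Binary.PropositionalEquality using (_≡_; _≢_)
open import Function.Definitions using (Injective)

countB : ∀ {m} → (Fin m → Bool) → ℕ
countB {zero}  f = 0
countB {suc m} f = (if f Fin.zero then 1 else 0) + countB (λ i → f (Fin.suc i))

data End (n : ℕ) : Set where
  dangling : Fin n → End n
  proper   : (u v : Fin n) → u ≢ v → End n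

incident : ∀ {n} → End n → Fin n → Bool
incident (dangling u)   x = ⌊ u ≟ x ⌋
incident (proper u v _) x = ⌊ u ≟ x ⌋ ∨ ⌊ v ≟ x ⌋

isDangling : ∀ {n} → End n → Bool
isDangling (dangling _)   = true
isDangling (proper _ _ _) = false

Joins : ∀ {n} → End n → Fin n → Fin n → Set
Joins (dangling _)   a b = ⊥
Joins (proper u v _) a b = (u ≡ a × v ≡ b) ⊎ (u ≡ b × v ≡ a)

-- A cubic 3-pole: vertices Fin n, edges Fin m (multiple edges allowed),
-- every vertex of degree 3, exactly three dangling edges (the spokes).
record Cubic3Pole : Set where
  field
    n m     : ℕ
    ends    : Fin m → End n
    cubic   : ∀ v → countB (λ e → incident (ends e) v) ≡ 3
    spokes3 : countB (λ e → isDangling (ends e)) ≡ 3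

  IsSpoke : Fin m → Set
  IsSpoke e = isDangling (ends e) ≡ true

  SpokeVertex : Fin n → Set
  SpokeVertex v = ∃[ e ] ends e ≡ dangling v

next : ∀ {n} → Fin n → Fin n
next {suc k} i = suc (toℕ i) mod suc k

cdist : ∀ {n} → Fin n → Fin n → ℕ
cdist {suc k} p q = (suc k + toℕ q ∸ toℕ p) % suc k

-- A Hamiltonian circuit, presented cyclically: positions 0..n-1 carry
-- the vertices pos 0, ..., pos (n-1) (each vertex exactly once), and the
-- distinct edges edge i join pos i with pos (i+1 mod n).
record HamCircuit (G : Cubic3Pole) : Set where
  open Cubic3Pole G
  field
    pos        : Fin n → Fin n
    pos-inj    : Injective _≡_ _≡_ pos
    edge       : Fin n → Fin m
    edge-inj   : Injective _≡_ _≡_ edge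
    edge-joins : ∀ i → Joins (ends (edge i)) (pos i) (pos (next i))

  InH : Fin m → Set
  InH e = ∃[ i ] edge i ≡ e

  -- Q = set of chords (edges not in H; this includes the spokes)
  IsChord : Fin m → Set
  IsChord e = ¬ InH e

Odd : ℕ → Set
Odd k = ∃[ j ] k ≡ suc (2 * j)

-- All three segments have odd length: whenever p, q are positions of
-- spoke end vertices, p ≠ q, and no spoke end vertex lies strictly between
-- them (going forward along H from p), the segment from p to q, which
-- consists of cdist p q edges of H, has odd length.
AllSegmentsOdd : (G : Cubic3Pole) → HamCircuit G → Set
AllSegmentsOdd G H =
  ∀ (p q : Fin n) → SpokeVertex (pos p) → SpokeVertex (pos q) → p ≢ q →
  (∀ r → SpokeVertex (pos r) → ¬ (0 < cdist p r × cdist p r < cdist p q)) →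
  Odd (cdist p q)
  where open Cubic3Pole G
        open HamCircuit H

-- perfect matching: a set of edges (dangling allowed) covering every vertex exactly once
PerfectMatching : (G : Cubic3Pole) → (Fin (Cubic3Pole.m G) → Bool) → Set
PerfectMatching G M = ∀ v → countB (λ e → M e ∧ incident (ends e) v) ≡ 1
  where open Cubic3Pole G

-- proper 4-cover: M 0, M 1, M 2, M 3 (= M1..M4 of the paper)
ProperFourCover : (G : Cubic3Pole) → HamCircuit G →
                  (Fin 4 → Fin (Cubic3Pole.m G) → Bool) → Set
ProperFourCover G H M =
  (∀ i → PerfectMatching G (M i))
  × (∀ e → ∃[ i ] M i e ≡ true)
  × (∀ e → (M (Fin.suc (Fin.suc (Fin.suc Fin.zero))) e ≡ true → IsChord e)
         × (IsChord e → M (Fin.suc (Fin.suc (Fin.suc Fin.zero))) e ≡ true))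
  × (∀ e → IsSpoke e → countB (λ i → M i e) ≡ 2)
  where open Cubic3Pole G
        open HamCircuit H

-- Number the vertices pos 0, …, pos (n − 1) along H, so that edge j of H joins positions j and j + 1 (mod n),
-- and let cdist p q be the forward distance from position p to position q. If p₀ < p₁ < p₂ are the positions of
-- the spoke ends, the segments have the odd lengths cdist p₀ p₁, cdist p₁ p₂ and cdist p₂ p₀, which add up to n;
-- so n is odd. For a spoke end p, the spoke at p together with the edges j of H for which cdist p j is odd is a
-- perfect matching: these are every other edge of the even path H − pos p. Every vertex meets exactly two edges
-- of H, so the chords form the fourth perfect matching. Every edge j of H lies beyond some spoke end q whose
-- predecessor is the spoke end p, that is cdist p j = cdist p q + cdist q j with cdist p q odd; so j lies in the
-- matching of p or in that of q. A spoke lies in its own matching and among the chords, and in no other matching.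

module Submission where

open import Defs
open import Data.Bool using (Bool; true; false; not; _∧_; _∨_; if_then_else_)
import Data.Bool.Properties as Boolₚ
open import Data.Fin as Fin using (Fin; zero; suc; toℕ; _≟_; _<_; _≤_)
import Data.Fin.Properties as Finₚ
open import Data.Nat as ℕ using (ℕ; _+_; _∸_; z≤n; s≤s)
import Data.Nat.Properties as ℕₚ
open import Data.Nat.DivMod using (_%_; m<n⇒m%n≡m; [m+n]%n≡m%n; n%n≡0)
open import Data.Parity.Base as ℙ using (Parity; 0ℙ; 1ℙ; _⁻¹)
open import Data.Parity.Properties using (+-homo-+; *-homo-*; ⁻¹-selfInverse)
open import Data.Product as Σ using (_×_; _,_; ∃-syntax)
open import Data.Sum using (_⊎_; inj₁; inj₂; [_,_]′)
open import Function using (_∘_; id)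
open import Function.Definitions using (Injective)
open import Relation.Binary.Definitions using (tri<; tri≈; tri>)
open import Relation.Binary.PropositionalEquality
open import Relation.Nullary using (¬_; Dec; yes; no; contradiction)
open import Relation.Nullary.Decidable using (⌊_⌋; ⌊⌋-map′; isYes≗does; dec-true; dec-false)

⌊⌋-true : ∀ {A : Set} (a? : Dec A) → A → ⌊ a? ⌋ ≡ true
⌊⌋-true a? a = trans (isYes≗does a?) (dec-true a? a)

⌊⌋-false : ∀ {A : Set} (a? : Dec A) → ¬ A → ⌊ a? ⌋ ≡ false
⌊⌋-false a? ¬a = trans (isYes≗does a?) (dec-false a? ¬a)

ind : Bool → ℕ
ind b = if b then 1 else 0

countB-cong : ∀ {m} {f g : Fin m → Bool} → (∀ x → f x ≡ g x) → countB f ≡ countB g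
countB-cong {ℕ.zero}  f≗g = refl
countB-cong {ℕ.suc m} f≗g = cong₂ _+_ (cong ind (f≗g zero)) (countB-cong (f≗g ∘ suc))

countB-false : ∀ {m} {f : Fin m → Bool} → (∀ x → f x ≡ false) → countB f ≡ 0
countB-false {ℕ.zero}  f≗false = refl
countB-false {ℕ.suc m} f≗false rewrite f≗false zero = countB-false (f≗false ∘ suc)

countB-pos : ∀ {m} {f : Fin m → Bool} a → f a ≡ true → 1 ℕ.≤ countB f
countB-pos         zero    fa rewrite fa = s≤s z≤n
countB-pos {f = f} (suc a) fa = ℕₚ.≤-trans (countB-pos a fa) (ℕₚ.m≤n+m _ (ind (f zero)))

countB-∨ : ∀ {m} (f g : Fin m → Bool) → (∀ x → f x ≡ true → g x ≡ false) →
           countB (λ x → f x ∨ g x) ≡ countB f + countB g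
countB-∨ {ℕ.zero}  f g disjoint = refl
countB-∨ {ℕ.suc m} f g disjoint
  with f zero in f0 | g zero in g0 | countB-∨ (f ∘ suc) (g ∘ suc) (disjoint ∘ suc)
... | true  | true  | _  = contradiction (trans (sym g0) (disjoint zero f0)) λ ()
... | true  | false | ih = cong ℕ.suc ih
... | false | true  | ih = trans (cong ℕ.suc ih) (sym (ℕₚ.+-suc _ _))
... | false | false | ih = ih

countB-singleton : ∀ {m} (a : Fin m) (g : Fin m → Bool) → countB (λ x → ⌊ x ≟ a ⌋ ∧ g x) ≡ ind (g a)
countB-singleton {ℕ.suc m} zero    g =
  trans (cong (ind (g zero) +_) (countB-false {m} λ _ → refl)) (ℕₚ.+-identityʳ _)
countB-singleton {ℕ.suc m} (suc a) g =
  trans (countB-cong λ x → cong (_∧ g (suc x)) (⌊⌋-map′ _ _ (x ≟ a)))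
        (countB-singleton a (λ x → g (suc x)))

countB-unique : ∀ {m} {f : Fin m → Bool} a → f a ≡ true → (∀ x → f x ≡ true → x ≡ a) →
                ∀ g → countB (λ x → f x ∧ g x) ≡ ind (g a)
countB-unique {f = f} a fa unique g = trans (countB-cong f∧g≗) (countB-singleton a g)
  where
  f∧g≗ : ∀ x → f x ∧ g x ≡ ⌊ x ≟ a ⌋ ∧ g x
  f∧g≗ x with x ≟ a | f x in fx
  ... | yes refl | _     = cong (_∧ g a) (trans (sym fx) fa)
  ... | no  x≢a  | true  = contradiction (unique x fx) x≢a
  ... | no  _    | false = refl

countB≤1⇒unique : ∀ {m} {f : Fin m → Bool} → countB f ℕ.≤ 1 → ∀ a b → f a ≡ true → f b ≡ true → a ≡ b
countB≤1⇒unique         c≤1 zero    zero    fa fb = refl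
countB≤1⇒unique         c≤1 zero    (suc b) fa fb rewrite fa =
  contradiction (ℕₚ.≤-trans (countB-pos b fb) (ℕₚ.+-cancelˡ-≤ 1 _ _ c≤1)) λ ()
countB≤1⇒unique         c≤1 (suc a) zero    fa fb rewrite fb =
  contradiction (ℕₚ.≤-trans (countB-pos a fa) (ℕₚ.+-cancelˡ-≤ 1 _ _ c≤1)) λ ()
countB≤1⇒unique {f = f} c≤1 (suc a) (suc b) fa fb =
  cong suc (countB≤1⇒unique (ℕₚ.≤-trans (ℕₚ.m≤n+m _ (ind (f zero))) c≤1) a b fa fb)

image : ∀ {n m} → (Fin n → Fin m) → (Fin n → Bool) → Fin m → Bool
image {ℕ.zero}  f S y = false
image {ℕ.suc n} f S y = (⌊ y ≟ f zero ⌋ ∧ S zero) ∨ image (λ j → f (suc j)) (λ j → S (suc j)) y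

image-intro : ∀ {n m} (f : Fin n → Fin m) S j → S j ≡ true → image f S (f j) ≡ true
image-intro f S zero    Sj rewrite ⌊⌋-true (f zero ≟ f zero) refl | Sj = refl
image-intro f S (suc j) Sj rewrite image-intro (λ j → f (suc j)) (λ j → S (suc j)) j Sj =
  Boolₚ.∨-zeroʳ _

image-elim : ∀ {n m} (f : Fin n → Fin m) S y → image f S y ≡ true → ∃[ j ] S j ≡ true × f j ≡ y
image-elim {ℕ.suc n} f S y img with y ≟ f zero | S zero in S0
... | yes refl | true  = zero , S0 , refl
... | yes refl | false = Σ.map suc id (image-elim _ _ y img)
... | no _     | _     = Σ.map suc id (image-elim _ _ y img)

countB-image : ∀ {n m} {f : Fin n → Fin m} → Injective _≡_ _≡_ f →
               (S : Fin n → Bool) (h : Fin m → Bool) →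
               countB (λ y → image f S y ∧ h y) ≡ countB (λ j → S j ∧ h (f j))
countB-image {ℕ.zero}  {m}         f-inj S h = countB-false {m} λ _ → refl
countB-image {ℕ.suc n} {m} {f = f} f-inj S h = begin
  countB (λ y → ((⌊ y ≟ f zero ⌋ ∧ S zero) ∨ image′ y) ∧ h y)
    ≡⟨ countB-cong (λ y → trans (Boolₚ.∧-distribʳ-∨ (h y) _ (image′ y))
                                  (cong (_∨ image′ y ∧ h y) (Boolₚ.∧-assoc ⌊ y ≟ f zero ⌋ (S zero) (h y)))) ⟩
  countB (λ y → (⌊ y ≟ f zero ⌋ ∧ (S zero ∧ h y)) ∨ (image′ y ∧ h y))
    ≡⟨ countB-∨ _ _ disjoint ⟩
  countB (λ y → ⌊ y ≟ f zero ⌋ ∧ (S zero ∧ h y)) + countB (λ y → image′ y ∧ h y)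
    ≡⟨ cong₂ _+_ (countB-singleton (f zero) _) (countB-image (Finₚ.suc-injective ∘ f-inj) _ h) ⟩
  ind (S zero ∧ h (f zero)) + countB (λ j → S (suc j) ∧ h (f (suc j))) ∎
  where
  open ≡-Reasoning
  image′ : Fin m → Bool
  image′ = image (λ j → f (suc j)) (λ j → S (suc j))
  disjoint : ∀ y → ⌊ y ≟ f zero ⌋ ∧ (S zero ∧ h y) ≡ true → image′ y ∧ h y ≡ false
  disjoint y _  with y ≟ f zero | image′ y in img
  disjoint y _  | yes refl | true
    with j , _ , fj≡f0 ← image-elim (λ j → f (suc j)) _ y img = contradiction (f-inj fj≡f0) λ ()
  disjoint y _  | yes refl | false = refl
  disjoint y () | no _     | _

countB-split : ∀ {m} (f g : Fin m → Bool) →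
               countB f ≡ countB (λ x → g x ∧ f x) + countB (λ x → not (g x) ∧ f x)
countB-split f g = trans (countB-cong λ x → split (g x) (f x)) (countB-∨ _ _ λ x → disjoint (g x) (f x))
  where
  split : ∀ b c → c ≡ (b ∧ c) ∨ (not b ∧ c)
  split true  c = sym (Boolₚ.∨-identityʳ c)
  split false c = refl
  disjoint : ∀ b c → b ∧ c ≡ true → not b ∧ c ≡ false
  disjoint true c _ = refl

countB-witness : ∀ {m} {f : Fin m → Bool} {k} → countB f ≡ ℕ.suc k → ∃[ a ] f a ≡ true
countB-witness {f = f} count≡1+k with Finₚ.any? (λ x → f x Boolₚ.≟ true)
... | yes found  = found
... | no  ¬found =
  contradiction (trans (sym count≡1+k) (countB-false λ x → Boolₚ.¬-not λ fx → ¬found (x , fx))) λ ()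

infixl 6 _without_
_without_ : ∀ {m} → (Fin m → Bool) → Fin m → Fin m → Bool
(f without a) x = not ⌊ x ≟ a ⌋ ∧ f x

without⁺ : ∀ {m} {f : Fin m → Bool} {a x} → x ≢ a → f x ≡ true → (f without a) x ≡ true
without⁺ {a = a} {x} x≢a fx rewrite ⌊⌋-false (x ≟ a) x≢a = fx

without⁻ : ∀ {m} {f : Fin m → Bool} {a x} → (f without a) x ≡ true → x ≢ a × f x ≡ true
without⁻ {a = a} {x} kept with x ≟ a
... | no x≢a = x≢a , kept

countB-peel : ∀ {m} {f : Fin m → Bool} {k} → countB f ≡ ℕ.suc k →
              ∃[ a ] f a ≡ true × countB (f without a) ≡ k
countB-peel {f = f} count≡1+k with a , fa ← countB-witness count≡1+k =
  a , fa , ℕₚ.suc-injective (begin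
    ℕ.suc (countB (f without a))
      ≡⟨ cong (λ b → ind b + countB (f without a)) (sym fa) ⟩
    ind (f a) + countB (f without a)
      ≡⟨ cong (_+ countB (f without a)) (sym (countB-singleton a f)) ⟩
    countB (λ x → ⌊ x ≟ a ⌋ ∧ f x) + countB (f without a)
      ≡⟨ sym (countB-split f (λ x → ⌊ x ≟ a ⌋)) ⟩
    countB f
      ≡⟨ count≡1+k ⟩
    ℕ.suc _ ∎)
  where open ≡-Reasoning

⌊≟⌋-injective : ∀ {n m} {f : Fin n → Fin m} → Injective _≡_ _≡_ f → ∀ a b → ⌊ f a ≟ f b ⌋ ≡ ⌊ a ≟ b ⌋
⌊≟⌋-injective f-inj a b with a ≟ b
... | yes refl = ⌊⌋-true _ refl
... | no  a≢b  = ⌊⌋-false _ (a≢b ∘ f-inj)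

injective⇒surjective : ∀ {n} {f : Fin n → Fin n} → Injective _≡_ _≡_ f → ∀ y → ∃[ x ] f x ≡ y
injective⇒surjective {ℕ.suc k} {f} f-inj y with Finₚ.any? (λ x → f x ≟ y)
... | yes found  = found
... | no  ¬found = contradiction (Finₚ.injective⇒≤ punched-injective) ℕₚ.1+n≰n
  where
  y≢f : ∀ x → y ≢ f x
  y≢f x y≡fx = ¬found (x , sym y≡fx)
  punched-injective : Injective _≡_ _≡_ (λ x → Fin.punchOut (y≢f x))
  punched-injective eq = f-inj (Finₚ.punchOut-injective (y≢f _) (y≢f _) eq)

In₃ : ∀ {A : Set} → A → A → A → A → Set
In₃ x a b c = x ≡ a ⊎ x ≡ b ⊎ x ≡ c

pattern first  = inj₁ refl
pattern second = inj₂ (inj₁ refl)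
pattern third  = inj₂ (inj₂ refl)

In₃-⊆ : ∀ {A : Set} {a b c a′ b′ c′ : A} → In₃ a a′ b′ c′ → In₃ b a′ b′ c′ → In₃ c a′ b′ c′ →
        ∀ {x} → In₃ x a b c → In₃ x a′ b′ c′
In₃-⊆ a∈ b∈ c∈ first  = a∈
In₃-⊆ a∈ b∈ c∈ second = b∈
In₃-⊆ a∈ b∈ c∈ third  = c∈

record Triple {A : Set} (P : A → Set) : Set where
  field
    a b c    : A
    a≢b      : a ≢ b
    a≢c      : a ≢ c
    b≢c      : b ≢ c
    Pa       : P a
    Pb       : P b
    Pc       : P c
    complete : ∀ x → P x → In₃ x a b c

record SortedTriple {n} (P : Fin n → Set) : Set where
  field
    p₀ p₁ p₂ : Fin n
    p₀<p₁    : p₀ < p₁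
    p₁<p₂    : p₁ < p₂
    P₀       : P p₀
    P₁       : P p₁
    P₂       : P p₂
    complete : ∀ x → P x → In₃ x p₀ p₁ p₂

module _ {n} {P : Fin n → Set} (t : Triple P) where
  open Triple t

  private
    sorted : ∀ {x y z} → x < y → y < z → P x → P y → P z →
             In₃ a x y z → In₃ b x y z → In₃ c x y z → SortedTriple P
    sorted x<y y<z Px Py Pz a∈ b∈ c∈ = record
      { p₀<p₁ = x<y ; p₁<p₂ = y<z ; P₀ = Px ; P₁ = Py ; P₂ = Pz
      ; complete = λ w Pw → In₃-⊆ a∈ b∈ c∈ (complete w Pw) }

  sortTriple : SortedTriple P
  sortTriple with Finₚ.<-cmp a b | Finₚ.<-cmp b c | Finₚ.<-cmp a c
  ... | tri≈ _ a≡b _ | _            | _            = contradiction a≡b a≢b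
  ... | _            | tri≈ _ b≡c _ | _            = contradiction b≡c b≢c
  ... | _            | _            | tri≈ _ a≡c _ = contradiction a≡c a≢c
  ... | tri< a<b _ _ | tri< b<c _ _ | _            = sorted a<b b<c Pa Pb Pc first  second third
  ... | tri< _   _ _ | tri> _ _ c<b | tri< a<c _ _ = sorted a<c c<b Pa Pc Pb first  third  second
  ... | tri< a<b _ _ | tri> _ _ c<b | tri> _ _ c<a = sorted c<a a<b Pc Pa Pb second third  first
  ... | tri> _ _ b<a | tri< b<c _ _ | tri< a<c _ _ = sorted b<a a<c Pb Pa Pc second first  third
  ... | tri> _ _ _   | tri< b<c _ _ | tri> _ _ c<a = sorted b<c c<a Pb Pc Pa third  first  second
  ... | tri> _ _ b<a | tri> _ _ c<b | _            = sorted c<b b<a Pc Pb Pa third  second first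

countB≡3⇒Triple : ∀ {m} {f : Fin m → Bool} → countB f ≡ 3 → Triple (λ x → f x ≡ true)
countB≡3⇒Triple {f = f} count≡3
  with a , fa  , count≡2 ← countB-peel count≡3
  with b , fb′ , count≡1 ← countB-peel count≡2
  with c , fc″ , count≡0 ← countB-peel count≡1
  with b≢a , fb ← without⁻ {f = f} fb′
  with c≢b , fc′ ← without⁻ {f = f without a} fc″
  with c≢a , fc ← without⁻ {f = f} fc′ = record
  { a≢b = b≢a ∘ sym ; a≢c = c≢a ∘ sym ; b≢c = c≢b ∘ sym
  ; Pa = fa ; Pb = fb ; Pc = fc ; complete = complete }
  where
  complete : ∀ x → f x ≡ true → In₃ x a b c
  complete x fx with x ≟ a | x ≟ b | x ≟ c
  ... | yes x≡a | _       | _       = inj₁ x≡a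
  ... | no _    | yes x≡b | _       = inj₂ (inj₁ x≡b)
  ... | no _    | no _    | yes x≡c = inj₂ (inj₂ x≡c)
  ... | no x≢a  | no x≢b  | no x≢c  =
    contradiction (ℕₚ.≤-trans (countB-pos x x-left) (ℕₚ.≤-reflexive count≡0)) λ ()
    where
    x-left : (f without a without b without c) x ≡ true
    x-left = without⁺ {f = f without a without b} x≢c
               (without⁺ {f = f without a} x≢b (without⁺ {f = f} x≢a fx))

Triple-image : ∀ {A B : Set} {P : A → Set} (R : A → B → Set) →
               (∀ {x} → P x → ∃[ y ] R x y) → (∀ {x y} → R x y → P x) →
               (∀ {x x′ y} → R x y → R x′ y → x ≡ x′) → (∀ {x y y′} → R x y → R x y′ → y ≡ y′) →
               Triple P → Triple (λ y → ∃[ x ] R x y)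
Triple-image R total R⇒P injective functional t
  with ya , Ra ← total (Triple.Pa t)
  with yb , Rb ← total (Triple.Pb t)
  with yc , Rc ← total (Triple.Pc t) = record
  { a≢b = λ { refl → a≢b (injective Ra Rb) }
  ; a≢c = λ { refl → a≢c (injective Ra Rc) }
  ; b≢c = λ { refl → b≢c (injective Rb Rc) }
  ; Pa = a , Ra ; Pb = b , Rb ; Pc = c , Rc
  ; complete = λ { y (x , Rxy) → image-complete Rxy (complete x (R⇒P Rxy)) }
  }
  where
  open Triple t
  image-complete : ∀ {x y} → R x y → In₃ x a b c → In₃ y ya yb yc
  image-complete Rxy first  = inj₁ (functional Rxy Ra)
  image-complete Rxy second = inj₂ (inj₁ (functional Rxy Rb))
  image-complete Rxy third  = inj₂ (inj₂ (functional Rxy Rc))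

∸-split : ∀ {a b c} → a ℕ.≤ b → b ℕ.≤ c → c ∸ a ≡ (b ∸ a) + (c ∸ b)
∸-split {a} {b} {c} a≤b b≤c = begin
  c ∸ a             ≡⟨ cong (_∸ a) (sym (ℕₚ.m∸n+n≡m b≤c)) ⟩
  (c ∸ b) + b ∸ a   ≡⟨ ℕₚ.+-∸-assoc (c ∸ b) a≤b ⟩
  (c ∸ b) + (b ∸ a) ≡⟨ ℕₚ.+-comm (c ∸ b) _ ⟩
  (b ∸ a) + (c ∸ b) ∎
  where open ≡-Reasoning

cdist-≤ : ∀ {n} {p q : Fin n} → p ≤ q → cdist p q ≡ toℕ q ∸ toℕ p
cdist-≤ {n@(ℕ.suc _)} {p} {q} p≤q = begin
  (n + toℕ q ∸ toℕ p) % n   ≡⟨ cong (_% n) (ℕₚ.+-∸-assoc n {toℕ q} p≤q) ⟩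
  (n + (toℕ q ∸ toℕ p)) % n ≡⟨ cong (_% n) (ℕₚ.+-comm n _) ⟩
  ((toℕ q ∸ toℕ p) + n) % n ≡⟨ [m+n]%n≡m%n (toℕ q ∸ toℕ p) n ⟩
  (toℕ q ∸ toℕ p) % n       ≡⟨ m<n⇒m%n≡m (ℕₚ.≤-<-trans (ℕₚ.m∸n≤m (toℕ q) (toℕ p)) (Finₚ.toℕ<n q)) ⟩
  toℕ q ∸ toℕ p             ∎
  where open ≡-Reasoning

cdist-> : ∀ {n} {p q : Fin n} → q < p → cdist p q ≡ n + toℕ q ∸ toℕ p
cdist-> {n@(ℕ.suc _)} {p} {q} q<p = m<n⇒m%n≡m (begin-strict
  n + toℕ q ∸ toℕ p     ≡⟨ ℕₚ.+-∸-comm (toℕ q) p≤n ⟩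
  (n ∸ toℕ p) + toℕ q   <⟨ ℕₚ.+-monoʳ-< (n ∸ toℕ p) q<p ⟩
  (n ∸ toℕ p) + toℕ p   ≡⟨ ℕₚ.m∸n+n≡m p≤n ⟩
  n                     ∎)
  where
  open ℕₚ.≤-Reasoning
  p≤n : toℕ p ℕ.≤ n
  p≤n = ℕₚ.<⇒≤ (Finₚ.toℕ<n p)

cdist-self : ∀ {n} (p : Fin n) → cdist p p ≡ 0
cdist-self p = trans (cdist-≤ {p = p} ℕₚ.≤-refl) (ℕₚ.n∸n≡0 (toℕ p))

toℕ≤n+ : ∀ {n} (p : Fin n) k → toℕ p ℕ.≤ n + k
toℕ≤n+ {n} p k = ℕₚ.≤-trans (ℕₚ.<⇒≤ (Finₚ.toℕ<n p)) (ℕₚ.m≤m+n n k)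

-- q lies on the forward arc from p to r.
data InArc {n} (p q r : Fin n) : Set where
  p≤q≤r : p ≤ q → q ≤ r → InArc p q r
  q≤r<p : q ≤ r → r < p → InArc p q r
  r<p≤q : r < p → p ≤ q → InArc p q r

cdist-split : ∀ {n} {p q r : Fin n} → InArc p q r → cdist p r ≡ cdist p q + cdist q r
cdist-split {n} {p} {q} {r} (p≤q≤r p≤q q≤r) = begin
  cdist p r                         ≡⟨ cdist-≤ (ℕₚ.≤-trans p≤q q≤r) ⟩
  toℕ r ∸ toℕ p                     ≡⟨ ∸-split p≤q q≤r ⟩
  (toℕ q ∸ toℕ p) + (toℕ r ∸ toℕ q) ≡⟨ sym (cong₂ _+_ (cdist-≤ p≤q) (cdist-≤ q≤r)) ⟩
  cdist p q + cdist q r             ∎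
  where open ≡-Reasoning
cdist-split {n} {p} {q} {r} (q≤r<p q≤r r<p) = begin
  cdist p r
    ≡⟨ cdist-> r<p ⟩
  n + toℕ r ∸ toℕ p
    ≡⟨ ∸-split (toℕ≤n+ p (toℕ q)) (ℕₚ.+-monoʳ-≤ n q≤r) ⟩
  (n + toℕ q ∸ toℕ p) + ((n + toℕ r) ∸ (n + toℕ q))
    ≡⟨ cong ((n + toℕ q ∸ toℕ p) +_) (ℕₚ.[m+n]∸[m+o]≡n∸o n _ _) ⟩
  (n + toℕ q ∸ toℕ p) + (toℕ r ∸ toℕ q)
    ≡⟨ sym (cong₂ _+_ (cdist-> (ℕₚ.≤-<-trans q≤r r<p)) (cdist-≤ q≤r)) ⟩
  cdist p q + cdist q r ∎
  where open ≡-Reasoning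
cdist-split {n} {p} {q} {r} (r<p≤q r<p p≤q) = begin
  cdist p r
    ≡⟨ cdist-> r<p ⟩
  n + toℕ r ∸ toℕ p
    ≡⟨ ∸-split p≤q (toℕ≤n+ q (toℕ r)) ⟩
  (toℕ q ∸ toℕ p) + (n + toℕ r ∸ toℕ q)
    ≡⟨ sym (cong₂ _+_ (cdist-≤ p≤q) (cdist-> (ℕₚ.<-≤-trans r<p p≤q))) ⟩
  cdist p q + cdist q r ∎
  where open ≡-Reasoning

cdist-cycle : ∀ {n} {p q : Fin n} → p < q → cdist p q + cdist q p ≡ n
cdist-cycle {n} {p} {q} p<q = begin
  cdist p q + cdist q p                 ≡⟨ cong₂ _+_ (cdist-≤ (ℕₚ.<⇒≤ p<q)) (cdist-> p<q) ⟩
  (toℕ q ∸ toℕ p) + (n + toℕ p ∸ toℕ q) ≡⟨ sym (∸-split (ℕₚ.<⇒≤ p<q) (toℕ≤n+ q (toℕ p))) ⟩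
  n + toℕ p ∸ toℕ p                     ≡⟨ ℕₚ.m+n∸n≡m n (toℕ p) ⟩
  n                                     ∎
  where open ≡-Reasoning

toℕ-next : ∀ {k} (j : Fin (ℕ.suc k)) → toℕ (next j) ≡ ℕ.suc (toℕ j) ⊎ (toℕ j ≡ k × toℕ (next j) ≡ 0)
toℕ-next {k} j with toℕ j ℕ.<? k
... | yes j<k = inj₁ (trans (Finₚ.toℕ-fromℕ< _) (m<n⇒m%n≡m (s≤s j<k)))
... | no  j≮k = inj₂ (j≡k , trans (Finₚ.toℕ-fromℕ< _) (begin
  ℕ.suc (toℕ j) % ℕ.suc k ≡⟨ cong (λ x → ℕ.suc x % ℕ.suc k) j≡k ⟩
  ℕ.suc k % ℕ.suc k       ≡⟨ n%n≡0 (ℕ.suc k) ⟩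
  0                       ∎))
  where
  open ≡-Reasoning
  j≡k : toℕ j ≡ k
  j≡k = ℕₚ.≤∧≮⇒≡ (ℕ.s≤s⁻¹ (Finₚ.toℕ<n j)) j≮k

next-injective : ∀ {n} → Injective _≡_ _≡_ (next {n})
next-injective {ℕ.suc k} {i} {j} i⁺≡j⁺ with toℕ-next i | toℕ-next j
... | inj₁ i⁺ | inj₁ j⁺ =
  Finₚ.toℕ-injective (ℕₚ.suc-injective (trans (sym i⁺) (trans (cong toℕ i⁺≡j⁺) j⁺)))
... | inj₁ i⁺ | inj₂ (_ , j⁺) = contradiction (trans (sym i⁺) (trans (cong toℕ i⁺≡j⁺) j⁺)) λ ()
... | inj₂ (_ , i⁺) | inj₁ j⁺ = contradiction (trans (sym i⁺) (trans (cong toℕ i⁺≡j⁺) j⁺)) λ ()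
... | inj₂ (i≡k , _) | inj₂ (j≡k , _) = Finₚ.toℕ-injective (trans i≡k (sym j≡k))

cdist-next : ∀ {n} {p j : Fin n} → p ≢ next j → cdist p (next j) ≡ ℕ.suc (cdist p j)
cdist-next {n@(ℕ.suc k)} {p} {j} p≢j⁺ with toℕ-next j
... | inj₁ j⁺≡ with ℕ.<-cmp (toℕ p) (ℕ.suc (toℕ j))
...   | tri< (s≤s p≤j) _ _ = begin
  cdist p (next j)           ≡⟨ cdist-≤ (subst (toℕ p ℕ.≤_) (sym j⁺≡) (ℕₚ.m≤n⇒m≤1+n p≤j)) ⟩
  toℕ (next j) ∸ toℕ p       ≡⟨ cong (_∸ toℕ p) j⁺≡ ⟩
  ℕ.suc (toℕ j) ∸ toℕ p      ≡⟨ ℕₚ.+-∸-assoc 1 p≤j ⟩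
  ℕ.suc (toℕ j ∸ toℕ p)      ≡⟨ cong ℕ.suc (sym (cdist-≤ p≤j)) ⟩
  ℕ.suc (cdist p j)          ∎
  where open ≡-Reasoning
...   | tri≈ _ p≡j⁺ _ = contradiction (Finₚ.toℕ-injective (trans p≡j⁺ (sym j⁺≡))) p≢j⁺
...   | tri> _ _ j⁺<p = begin
  cdist p (next j)           ≡⟨ cdist-> (subst (ℕ._< toℕ p) (sym j⁺≡) j⁺<p) ⟩
  n + toℕ (next j) ∸ toℕ p   ≡⟨ cong (λ x → n + x ∸ toℕ p) j⁺≡ ⟩
  n + ℕ.suc (toℕ j) ∸ toℕ p  ≡⟨ cong (_∸ toℕ p) (ℕₚ.+-suc n _) ⟩
  ℕ.suc (n + toℕ j) ∸ toℕ p  ≡⟨ ℕₚ.+-∸-assoc 1 (toℕ≤n+ p (toℕ j)) ⟩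
  ℕ.suc (n + toℕ j ∸ toℕ p)  ≡⟨ cong ℕ.suc (sym (cdist-> (ℕₚ.<-trans (ℕₚ.n<1+n _) j⁺<p))) ⟩
  ℕ.suc (cdist p j)          ∎
  where open ≡-Reasoning
cdist-next {n@(ℕ.suc k)} {p} {j} p≢j⁺ | inj₂ (j≡k , j⁺≡0) with toℕ p ℕ.≟ 0
... | yes p≡0 = contradiction (Finₚ.toℕ-injective (trans p≡0 (sym j⁺≡0))) p≢j⁺
... | no  p≢0 = begin
  cdist p (next j)           ≡⟨ cdist-> (subst (ℕ._< toℕ p) (sym j⁺≡0) (ℕₚ.n≢0⇒n>0 p≢0)) ⟩
  n + toℕ (next j) ∸ toℕ p   ≡⟨ cong (λ x → n + x ∸ toℕ p) j⁺≡0 ⟩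
  n + 0 ∸ toℕ p              ≡⟨ cong (_∸ toℕ p) (ℕₚ.+-identityʳ n) ⟩
  ℕ.suc k ∸ toℕ p            ≡⟨ ℕₚ.+-∸-assoc 1 p≤k ⟩
  ℕ.suc (k ∸ toℕ p)          ≡⟨ cong (λ x → ℕ.suc (x ∸ toℕ p)) (sym j≡k) ⟩
  ℕ.suc (toℕ j ∸ toℕ p)      ≡⟨ cong ℕ.suc (sym (cdist-≤ (subst (toℕ p ℕ.≤_) (sym j≡k) p≤k))) ⟩
  ℕ.suc (cdist p j)          ∎
  where
  open ≡-Reasoning
  p≤k : toℕ p ℕ.≤ k
  p≤k = ℕ.s≤s⁻¹ (Finₚ.toℕ<n p)

suc-cdist-next : ∀ {n} (j : Fin n) → ℕ.suc (cdist (next j) j) ≡ n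
suc-cdist-next {ℕ.suc k} j with toℕ-next j
... | inj₁ j⁺≡ = cong ℕ.suc (begin
  cdist (next j) j                 ≡⟨ cdist-> (subst (toℕ j ℕ.<_) (sym j⁺≡) (ℕₚ.n<1+n _)) ⟩
  ℕ.suc k + toℕ j ∸ toℕ (next j)   ≡⟨ cong (ℕ.suc k + toℕ j ∸_) j⁺≡ ⟩
  k + toℕ j ∸ toℕ j                ≡⟨ ℕₚ.m+n∸n≡m k (toℕ j) ⟩
  k                                ∎)
  where open ≡-Reasoning
... | inj₂ (j≡k , j⁺≡0) = cong ℕ.suc (begin
  cdist (next j) j                 ≡⟨ cdist-≤ (subst (ℕ._≤ toℕ j) (sym j⁺≡0) z≤n) ⟩
  toℕ j ∸ toℕ (next j)             ≡⟨ cong (toℕ j ∸_) j⁺≡0 ⟩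
  toℕ j                            ≡⟨ j≡k ⟩
  k                                ∎)
  where open ≡-Reasoning

isOdd : Parity → Bool
isOdd 0ℙ = false
isOdd 1ℙ = true

parity-suc : ∀ k → ℕ.parity (ℕ.suc k) ≡ ℕ.parity k ⁻¹
parity-suc = +-homo-+ 1

parity-Odd : ∀ {k} → Odd k → ℕ.parity k ≡ 1ℙ
parity-Odd (j , refl) = trans (parity-suc (2 ℕ.* j)) (cong _⁻¹ (*-homo-* 2 j))

ind-isOdd-⁻¹ : ∀ π → ind (isOdd (π ⁻¹)) + ind (isOdd π) ≡ 1
ind-isOdd-⁻¹ 0ℙ = refl
ind-isOdd-⁻¹ 1ℙ = refl

atOddDistance : ∀ {n} → Fin n → Fin n → Bool
atOddDistance p j = isOdd (ℕ.parity (cdist p j))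

atOddDistance-alternates : ∀ {n} → ℕ.parity n ≡ 1ℙ → (p j : Fin n) →
  ind ⌊ p ≟ next j ⌋ + (ind (atOddDistance p (next j)) + ind (atOddDistance p j)) ≡ 1
atOddDistance-alternates {n} n-odd p j with p ≟ next j
... | yes refl =
  cong₂ (λ π π′ → 1 + (ind (isOdd π) + ind (isOdd π′))) (cong ℕ.parity (cdist-self (next j))) even-before
  where
  even-before : ℕ.parity (cdist (next j) j) ≡ 0ℙ
  even-before = sym (⁻¹-selfInverse (begin
    ℕ.parity (cdist (next j) j) ⁻¹      ≡⟨ sym (parity-suc (cdist (next j) j)) ⟩
    ℕ.parity (ℕ.suc (cdist (next j) j)) ≡⟨ cong ℕ.parity (suc-cdist-next j) ⟩
    ℕ.parity n                          ≡⟨ n-odd ⟩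
    1ℙ                                  ∎))
    where open ≡-Reasoning
... | no p≢j⁺ rewrite cdist-next p≢j⁺ | parity-suc (cdist p j) = ind-isOdd-⁻¹ (ℕ.parity (cdist p j))

atOddDistance-either : ∀ {n} {p q j : Fin n} → ℕ.parity (cdist p q) ≡ 1ℙ → InArc p q j →
                       atOddDistance p j ≡ true ⊎ atOddDistance q j ≡ true
atOddDistance-either {p = p} {q} {j} odd-pq q∈pj
  rewrite cdist-split q∈pj | +-homo-+ (cdist p q) (cdist q j) | odd-pq
  with ℕ.parity (cdist q j)
... | 0ℙ = inj₁ refl
... | 1ℙ = inj₂ refl

module HamiltonianPole (G : Cubic3Pole) (H : HamCircuit G) where
  open Cubic3Pole G
  open HamCircuit H

  onH : (Fin n → Bool) → Fin m → Bool
  onH = image edge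

  inH : Fin m → Bool
  inH = onH (λ _ → true)

  inH⇒InH : ∀ {e} → inH e ≡ true → InH e
  inH⇒InH {e} e∈H with j , _ , edge-j≡e ← image-elim edge _ e e∈H = j , edge-j≡e

  InH⇒inH : ∀ {e} → InH e → inH e ≡ true
  InH⇒inH (j , refl) = image-intro edge _ j refl

  H-edge-proper : ∀ j → isDangling (ends (edge j)) ≡ false
  H-edge-proper j with ends (edge j) | edge-joins j
  ... | proper _ _ _ | _ = refl

  next-≢ : ∀ j → next j ≢ j
  next-≢ j j⁺≡j with ends (edge j) | edge-joins j
  ... | proper _ _ u≢v | inj₁ (refl , refl) = u≢v (cong pos (sym j⁺≡j))
  ... | proper _ _ u≢v | inj₂ (refl , refl) = u≢v (cong pos j⁺≡j)

  pos∘next-injective : Injective _≡_ _≡_ (pos ∘ next)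
  pos∘next-injective = next-injective ∘ pos-inj

  -- Writing a vertex as pos (next j) makes edge j and edge (next j) its two edges on H.
  vertex-after : ∀ v → ∃[ j ] pos (next j) ≡ v
  vertex-after = injective⇒surjective pos∘next-injective

  incident-H : ∀ x j → incident (ends (edge x)) (pos (next j)) ≡ ⌊ x ≟ next j ⌋ ∨ ⌊ x ≟ j ⌋
  incident-H x j with ends (edge x) | edge-joins x
  ... | proper _ _ _ | inj₁ (refl , refl) =
    cong₂ _∨_ (⌊≟⌋-injective pos-inj x (next j)) (⌊≟⌋-injective pos∘next-injective x j)
  ... | proper _ _ _ | inj₂ (refl , refl) =
    trans (Boolₚ.∨-comm ⌊ pos (next x) ≟ pos (next j) ⌋ _)
          (cong₂ _∨_ (⌊≟⌋-injective pos-inj x (next j)) (⌊≟⌋-injective pos∘next-injective x j))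

  H-degree : ∀ S j →
             countB (λ e → onH S e ∧ incident (ends e) (pos (next j))) ≡ ind (S (next j)) + ind (S j)
  H-degree S j = begin
    countB (λ e → onH S e ∧ incident (ends e) (pos (next j)))
      ≡⟨ countB-image edge-inj S _ ⟩
    countB (λ x → S x ∧ incident (ends (edge x)) (pos (next j)))
      ≡⟨ countB-cong (λ x → trans (cong (S x ∧_) (incident-H x j)) (Boolₚ.∧-comm (S x) _)) ⟩
    countB (λ x → (⌊ x ≟ next j ⌋ ∨ ⌊ x ≟ j ⌋) ∧ S x)
      ≡⟨ countB-cong (λ x → Boolₚ.∧-distribʳ-∨ (S x) ⌊ x ≟ next j ⌋ ⌊ x ≟ j ⌋) ⟩
    countB (λ x → (⌊ x ≟ next j ⌋ ∧ S x) ∨ (⌊ x ≟ j ⌋ ∧ S x))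
      ≡⟨ countB-∨ _ _ disjoint ⟩
    countB (λ x → ⌊ x ≟ next j ⌋ ∧ S x) + countB (λ x → ⌊ x ≟ j ⌋ ∧ S x)
      ≡⟨ cong₂ _+_ (countB-singleton (next j) S) (countB-singleton j S) ⟩
    ind (S (next j)) + ind (S j) ∎
    where
    open ≡-Reasoning
    disjoint : ∀ x → ⌊ x ≟ next j ⌋ ∧ S x ≡ true → ⌊ x ≟ j ⌋ ∧ S x ≡ false
    disjoint x _  with x ≟ next j
    disjoint x _  | yes refl rewrite ⌊⌋-false (next j ≟ j) (next-≢ j) = refl
    disjoint x () | no _

  chord : Fin m → Bool
  chord e = not (inH e)

  chord⇔IsChord : ∀ e → (chord e ≡ true → IsChord e) × (IsChord e → chord e ≡ true)
  chord⇔IsChord e = (λ e∉H e∈H → contradiction (trans (sym e∉H) (cong not (InH⇒inH e∈H))) λ ())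
                  , (λ e∉H → cong not (Boolₚ.¬-not (e∉H ∘ inH⇒InH)))

  chords-perfect : PerfectMatching G chord
  chords-perfect v with j , refl ← vertex-after v = ℕₚ.+-cancelˡ-≡ 2 _ _ (begin
    2 + chords-at-v
      ≡⟨ cong (_+ chords-at-v) (sym (H-degree (λ _ → true) j)) ⟩
    countB (λ e → inH e ∧ incident (ends e) (pos (next j))) + chords-at-v
      ≡⟨ sym (countB-split _ inH) ⟩
    countB (λ e → incident (ends e) (pos (next j)))
      ≡⟨ cubic (pos (next j)) ⟩
    3 ∎)
    where
    open ≡-Reasoning
    chords-at-v : ℕ
    chords-at-v = countB (λ e → chord e ∧ incident (ends e) (pos (next j)))

  spoke-not-on-H : ∀ S {e} → isDangling (ends e) ≡ true → onH S e ≡ false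
  spoke-not-on-H S {e} dangling-e with onH S e in e∈H
  ... | false = refl
  ... | true with j , _ , refl ← image-elim edge S e e∈H =
    contradiction (trans (sym dangling-e) (H-edge-proper j)) λ ()

  spokeAt : Fin n → Fin m → Bool
  spokeAt v e = isDangling (ends e) ∧ incident (ends e) v

  spokeAt⁺ : ∀ {v e} → ends e ≡ dangling v → spokeAt v e ≡ true
  spokeAt⁺ {v} e-at-v rewrite e-at-v = ⌊⌋-true (v ≟ v) refl

  spokeAt⁻ : ∀ {v e} → spokeAt v e ≡ true → ends e ≡ dangling v
  spokeAt⁻ {v} {e} e-at-v with ends e
  ... | dangling u with u ≟ v
  ...   | yes refl = refl

  spoke-is-chord : ∀ {v e} → ends e ≡ dangling v → chord e ∧ incident (ends e) v ≡ true
  spoke-is-chord {v} {e} e-at-v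
    rewrite spoke-not-on-H (λ _ → true) (cong isDangling e-at-v) | e-at-v = ⌊⌋-true (v ≟ v) refl

  spoke-unique : ∀ {v e e′} → ends e ≡ dangling v → ends e′ ≡ dangling v → e ≡ e′
  spoke-unique {v} {e} {e′} e-at-v e′-at-v =
    countB≤1⇒unique (ℕₚ.≤-reflexive (chords-perfect v)) e e′ (spoke-is-chord e-at-v) (spoke-is-chord e′-at-v)

  spoke-degree : ∀ {v s} → ends s ≡ dangling v → ∀ w →
                 countB (λ e → spokeAt v e ∧ incident (ends e) w) ≡ ind ⌊ v ≟ w ⌋
  spoke-degree {v} {s} s-at-v w
    rewrite countB-unique s (spokeAt⁺ s-at-v) (λ x x-at-v → spoke-unique (spokeAt⁻ x-at-v) s-at-v)
                          (λ e → incident (ends e) w)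
          | s-at-v = refl

  alternating : Fin n → Fin m → Bool
  alternating p e = spokeAt (pos p) e ∨ onH (atOddDistance p) e

  alternating-perfect : ℕ.parity n ≡ 1ℙ → ∀ {p} → SpokeVertex (pos p) → PerfectMatching G (alternating p)
  alternating-perfect n-odd {p} (s , s-at-p) v with j , refl ← vertex-after v = begin
    countB (λ e → alternating p e ∧ at-v e)
      ≡⟨ countB-cong (λ e → Boolₚ.∧-distribʳ-∨ (at-v e) (spokeAt (pos p) e) _) ⟩
    countB (λ e → (spokeAt (pos p) e ∧ at-v e) ∨ (onH (atOddDistance p) e ∧ at-v e))
      ≡⟨ countB-∨ _ _ disjoint ⟩
    countB (λ e → spokeAt (pos p) e ∧ at-v e) + countB (λ e → onH (atOddDistance p) e ∧ at-v e)
      ≡⟨ cong₂ _+_ (spoke-degree s-at-p (pos (next j))) (H-degree (atOddDistance p) j) ⟩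
    ind ⌊ pos p ≟ pos (next j) ⌋ + (ind (atOddDistance p (next j)) + ind (atOddDistance p j))
      ≡⟨ cong (λ b → ind b + _) (⌊≟⌋-injective pos-inj p (next j)) ⟩
    ind ⌊ p ≟ next j ⌋ + (ind (atOddDistance p (next j)) + ind (atOddDistance p j))
      ≡⟨ atOddDistance-alternates n-odd p j ⟩
    1 ∎
    where
    open ≡-Reasoning
    at-v : Fin m → Bool
    at-v e = incident (ends e) (pos (next j))
    disjoint : ∀ e → spokeAt (pos p) e ∧ at-v e ≡ true → onH (atOddDistance p) e ∧ at-v e ≡ false
    disjoint e _ with isDangling (ends e) in dangling-e
    ... | true rewrite spoke-not-on-H (atOddDistance p) dangling-e = refl

  alternating-at-spoke : ∀ {e p} → ends e ≡ dangling (pos p) → ∀ q → alternating q e ≡ ⌊ p ≟ q ⌋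
  alternating-at-spoke {e} {p} e-at-p q
    rewrite spoke-not-on-H (atOddDistance q) (cong isDangling e-at-p) | e-at-p =
    trans (Boolₚ.∨-identityʳ _) (⌊≟⌋-injective pos-inj p q)

  alternating-on-H : ∀ {p j} → atOddDistance p j ≡ true → alternating p (edge j) ≡ true
  alternating-on-H {p} {j} odd =
    trans (cong (spokeAt (pos p) (edge j) ∨_) (image-intro edge _ j odd)) (Boolₚ.∨-zeroʳ _)

  SpokeEnd : Fin m → Fin n → Set
  SpokeEnd e p = ends e ≡ dangling (pos p)

  spoke-position : ∀ {e} → isDangling (ends e) ≡ true → ∃[ p ] SpokeEnd e p
  spoke-position {e} dangling-e with ends e
  ... | dangling u with p , refl ← injective⇒surjective pos-inj u = p , refl

  spokePositions : Triple (λ p → SpokeVertex (pos p))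
  spokePositions = Triple-image SpokeEnd spoke-position (cong isDangling) spoke-unique
                                (λ e-at-p e-at-p′ → pos-inj (dangling-injective (trans (sym e-at-p) e-at-p′)))
                                (countB≡3⇒Triple spokes3)
    where
    dangling-injective : ∀ {u v} → dangling {n} u ≡ dangling v → u ≡ v
    dangling-injective refl = refl

  module FourCover (segments-odd : AllSegmentsOdd G H) (s : SortedTriple (λ p → SpokeVertex (pos p))) where
    open SortedTriple s

    segment-odd : ∀ {p q t} → InArc p q t → p ≢ q → SpokeVertex (pos p) → SpokeVertex (pos q) →
                  (∀ r → SpokeVertex (pos r) → In₃ r p q t) → ℕ.parity (cdist p q) ≡ 1ℙ
    segment-odd {p} {q} {t} q∈pt p≢q spoke-p spoke-q spokes⊆pqt =
      parity-Odd (segments-odd p q spoke-p spoke-q p≢q no-spoke-between)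
      where
      no-spoke-between : ∀ r → SpokeVertex (pos r) → ¬ (0 ℕ.< cdist p r × cdist p r ℕ.< cdist p q)
      no-spoke-between r spoke-r (0<pr , pr<pq) with spokes⊆pqt r spoke-r
      ... | first  = ℕₚ.<-irrefl (sym (cdist-self p)) 0<pr
      ... | second = ℕₚ.<-irrefl refl pr<pq
      ... | third  = ℕₚ.<⇒≱ pr<pq (ℕₚ.≤-trans (ℕₚ.m≤m+n _ _) (ℕₚ.≤-reflexive (sym (cdist-split q∈pt))))

    arc₀₁₂ : InArc p₀ p₁ p₂
    arc₀₁₂ = p≤q≤r (ℕₚ.<⇒≤ p₀<p₁) (ℕₚ.<⇒≤ p₁<p₂)

    arc₁₂₀ : InArc p₁ p₂ p₀
    arc₁₂₀ = r<p≤q p₀<p₁ (ℕₚ.<⇒≤ p₁<p₂)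

    arc₂₀₁ : InArc p₂ p₀ p₁
    arc₂₀₁ = q≤r<p (ℕₚ.<⇒≤ p₀<p₁) p₁<p₂

    p₀<p₂ : p₀ < p₂
    p₀<p₂ = ℕₚ.<-trans p₀<p₁ p₁<p₂

    odd₀₁ : ℕ.parity (cdist p₀ p₁) ≡ 1ℙ
    odd₀₁ = segment-odd arc₀₁₂ (Finₚ.<⇒≢ p₀<p₁) P₀ P₁ complete

    odd₁₂ : ℕ.parity (cdist p₁ p₂) ≡ 1ℙ
    odd₁₂ = segment-odd arc₁₂₀ (Finₚ.<⇒≢ p₁<p₂) P₁ P₂ (λ r → In₃-⊆ third first second ∘ complete r)

    odd₂₀ : ℕ.parity (cdist p₂ p₀) ≡ 1ℙ
    odd₂₀ = segment-odd arc₂₀₁ (Finₚ.<⇒≢ p₀<p₂ ∘ sym) P₂ P₀ (λ r → In₃-⊆ second third first ∘ complete r)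

    n-odd : ℕ.parity n ≡ 1ℙ
    n-odd = begin
      ℕ.parity n
        ≡⟨ cong ℕ.parity (sym (cdist-cycle p₀<p₂)) ⟩
      ℕ.parity (cdist p₀ p₂ + cdist p₂ p₀)
        ≡⟨ cong (λ d → ℕ.parity (d + cdist p₂ p₀)) (cdist-split arc₀₁₂) ⟩
      ℕ.parity ((cdist p₀ p₁ + cdist p₁ p₂) + cdist p₂ p₀)
        ≡⟨ trans (+-homo-+ (cdist p₀ p₁ + cdist p₁ p₂) _)
                 (cong (ℙ._+ ℕ.parity (cdist p₂ p₀)) (+-homo-+ (cdist p₀ p₁) _)) ⟩
      ℕ.parity (cdist p₀ p₁) ℙ.+ ℕ.parity (cdist p₁ p₂) ℙ.+ ℕ.parity (cdist p₂ p₀)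
        ≡⟨ cong₂ ℙ._+_ (cong₂ ℙ._+_ odd₀₁ odd₁₂) odd₂₀ ⟩
      1ℙ ∎
      where open ≡-Reasoning

    H-covered : ∀ j → atOddDistance p₀ j ≡ true ⊎ atOddDistance p₁ j ≡ true ⊎ atOddDistance p₂ j ≡ true
    H-covered j with toℕ j ℕ.<? toℕ p₀ | toℕ j ℕ.<? toℕ p₁
    ... | yes j<p₀ | _        =
      inj₂ (atOddDistance-either odd₁₂ (r<p≤q (ℕₚ.<-trans j<p₀ p₀<p₁) (ℕₚ.<⇒≤ p₁<p₂)))
    ... | no  j≮p₀ | yes j<p₁ =
      [ inj₂ ∘ inj₂ , inj₁ ]′ (atOddDistance-either odd₂₀ (q≤r<p (ℕₚ.≮⇒≥ j≮p₀) (ℕₚ.<-trans j<p₁ p₁<p₂)))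
    ... | _        | no  j≮p₁ =
      [ inj₁ , inj₂ ∘ inj₁ ]′ (atOddDistance-either odd₀₁ (p≤q≤r (ℕₚ.<⇒≤ p₀<p₁) (ℕₚ.≮⇒≥ j≮p₁)))

    M : Fin 4 → Fin m → Bool
    M zero                   = alternating p₀
    M (suc zero)             = alternating p₁
    M (suc (suc zero))       = alternating p₂
    M (suc (suc (suc zero))) = chord

    perfect : ∀ i → PerfectMatching G (M i)
    perfect zero                   = alternating-perfect n-odd P₀
    perfect (suc zero)             = alternating-perfect n-odd P₁
    perfect (suc (suc zero))       = alternating-perfect n-odd P₂
    perfect (suc (suc (suc zero))) = chords-perfect

    covering : ∀ e → ∃[ i ] M i e ≡ true
    covering e with inH e in e∈H
    ... | false = suc (suc (suc zero)) , cong not e∈H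
    ... | true with j , refl ← inH⇒InH e∈H with H-covered j
    ...   | inj₁ odd        = zero , alternating-on-H odd
    ...   | inj₂ (inj₁ odd) = suc zero , alternating-on-H odd
    ...   | inj₂ (inj₂ odd) = suc (suc zero) , alternating-on-H odd

    spokes-twice : ∀ e → IsSpoke e → countB (λ i → M i e) ≡ 2
    spokes-twice e dangling-e with p , e-at-p ← spoke-position dangling-e
      rewrite alternating-at-spoke e-at-p p₀ | alternating-at-spoke e-at-p p₁ | alternating-at-spoke e-at-p p₂
            | spoke-not-on-H (λ _ → true) dangling-e
      with complete p (e , e-at-p)
    ... | first  rewrite ⌊⌋-true  (p₀ ≟ p₀) refl
                       | ⌊⌋-false (p₀ ≟ p₁) (Finₚ.<⇒≢ p₀<p₁)
                       | ⌊⌋-false (p₀ ≟ p₂) (Finₚ.<⇒≢ p₀<p₂) = refl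
    ... | second rewrite ⌊⌋-false (p₁ ≟ p₀) (Finₚ.<⇒≢ p₀<p₁ ∘ sym)
                       | ⌊⌋-true  (p₁ ≟ p₁) refl
                       | ⌊⌋-false (p₁ ≟ p₂) (Finₚ.<⇒≢ p₁<p₂) = refl
    ... | third  rewrite ⌊⌋-false (p₂ ≟ p₀) (Finₚ.<⇒≢ p₀<p₂ ∘ sym)
                       | ⌊⌋-false (p₂ ≟ p₁) (Finₚ.<⇒≢ p₁<p₂ ∘ sym)
                       | ⌊⌋-true  (p₂ ≟ p₂) refl = refl

lemma3p3 : (G : Cubic3Pole) (H : HamCircuit G) → AllSegmentsOdd G H →
    ∃[ M ] ProperFourCover G H M
lemma3p3 G H segments-odd = M , perfect , covering , chord⇔IsChord , spokes-twice
  where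
  open HamiltonianPole G H
  open FourCover segments-odd (sortTriple spokePositions)
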